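{- Let $k \ge 3$ be an integer and let $A_0 = \{a_1 < a_2 < \cdots < a_r\}$ be a set of even positive integers with $a_1 \ge 2$ and $a_r - a_1 \ge 1$, such that $r \ge f_k(a_r - a_1)$. Then there exist pairwise distinct integers $b_1, b_2, \ldots, b_k$ such that $b_i + b_j \in A_0$ for all $1 \le i < j \le k$.
   Context: For real $x \ge 1$ define $f_3(x) := \sqrt{x/2} + (x/2)^{1/4} + \tfrac12$, and for $k \ge 4$ define recursively $f_k(x) := \sqrt{2x f_{k-1}(x) + \tfrac14} + \tfrac12$. The integers $b_i$ are arbitrary integers (not required to be positive). -}

module Defs where

open import Data.Nat as ℕ using (ℕ; zero; suc)
open import Data.Integer as ℤ using (ℤ; +_)
open import Data.Rational using (ℚ; _/_; 0ℚ; ½; _+_; _*_; _≤_)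
open import Data.Product using (Σ; _×_)

toℚ : ℕ → ℚ
toℚ n = + n / 1

¼ : ℚ
¼ = + 1 / 4

-- Real numbers are not available, so the real number f_k(x) is represented
-- by its lower Dedekind cut: LowerF d x q means q ≤ (some rational
-- under-approximation of) f_{3+d}(x), and the supremum of
-- { q | LowerF d x q } is exactly f_{3+d}(x) (for x ≥ 1).
--
-- d = 0 :  f_3(x) = sqrt(x/2) + (x/2)^{1/4} + 1/2
--   q is in the cut iff q ≤ a + b + 1/2 for rationals a, b ≥ 0
--   with a^2 ≤ x/2 and b^4 ≤ x/2.
-- d + 1 :  f_{k}(x) = sqrt(2 x f_{k-1}(x) + 1/4) + 1/2
--   q is in the cut iff q ≤ c + 1/2 for a rational c ≥ 0 and some p in the
--   cut of f_{k-1}(x) with c^2 ≤ 2 x p + 1/4.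
LowerF : ℕ → ℕ → ℚ → Set
LowerF zero x q =
  Σ ℚ λ a → Σ ℚ λ b →
    (0ℚ ≤ a) × (0ℚ ≤ b) × (a * a ≤ + x / 2) × (b * b * b * b ≤ + x / 2)
    × (q ≤ a + b + ½)
LowerF (suc d) x q =
  Σ ℚ λ p → Σ ℚ λ c →
    LowerF d x p × (0ℚ ≤ c) × (c * c ≤ toℚ 2 * toℚ x * p + ¼) × (q ≤ c + ½)

-- f_k(x) ≤ r  (for k ≥ 3), i.e. r is an upper bound of the lower cut of f_k(x).
FBound : (k x : ℕ) → ℚ → Set
FBound k x r = (q : ℚ) → LowerF (k ℕ.∸ 3) x q → q ≤ r

-- With c = a / 2 the task is to find distinct integers whose pairwise sums are 2c,
-- c ∈ C, where C is a set of r integers of spread N = (a_r − a_1) / 2. Counting the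
-- r(r − 1)/2 pairs of C by their difference, some gap δ ≤ N is shared by at least
-- r(r − 1)/(2N) pairs, so the set S of their lower ends satisfies S + δ ⊆ C, and
-- colouring by the parity of ⌊c / δ⌋ leaves a δ-free half T of S. If b_1 … b_{k−1}
-- work for T and one of them is an anchor b = c₀ ∈ T, then adding b + 2δ gives k
-- anchored integers that work for C. The recursion f_k² − f_k = 2x f_{k−1} is exactly
-- what makes |T| ≥ f_{k−1}(x) whenever r ≥ f_k(x). At k = 4 the anchored triple comes
-- instead from two pairs v, v + d and w, w + d in S with d ≠ δ, which exist once
-- |S| ≥ 2⌊√N⌋ + 3; r ≥ f_4(x) gives this because f_3(x) ≥ ⌊√N⌋ + 3/2. For k = 3
-- any three elements of C do.

module Submission where

open import Defs

module CutBounds where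

  open import Data.Integer.Base as ℤ using (ℤ; +_)
  import Data.Integer.Properties as ℤ
  open import Data.Integer.Tactic.RingSolver as ℤ-Solver using ()
  open import Data.Nat.Base as ℕ using (ℕ; zero; suc)
  import Data.Nat.Properties as ℕ
  open import Data.Product.Base using (Σ; _×_; _,_)
  open import Data.Rational.Base as ℚ
    using (ℚ; _/_; 0ℚ; 1ℚ; ½; _+_; _-_; _*_; _≤_; _<_; _⊓_; 1/_; -_; Positive; NonZero; positive)
  import Data.Rational.Properties as ℚ
  open import Data.Rational.Unnormalised.Base as ℚᵘ using (mkℚᵘ; *≡*; *≤*; *<*)
  import Data.Rational.Unnormalised.Properties as ℚᵘ
  open import Data.Sum.Base using (inj₁; inj₂)
  open import Level using (0ℓ)
  open import Relation.Binary.PropositionalEquality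
  open import Relation.Nullary.Decidable using (toWitness; dec⇒maybe)
  open import Tactic.RingSolver using (solve-∀)
  open import Tactic.RingSolver.Core.AlmostCommutativeRing
    using (AlmostCommutativeRing; fromCommutativeRing)

  -- Without a zero test the solver cannot cancel rational coefficients.
  ℚ-ring : AlmostCommutativeRing 0ℓ 0ℓ
  ℚ-ring = fromCommutativeRing ℚ.+-*-commutativeRing (λ q → dec⇒maybe (0ℚ ℚ.≟ q))

  toℚᵘ-toℚ : ∀ n → ℚ.toℚᵘ (toℚ n) ℚᵘ.≃ mkℚᵘ (+ n) 0
  toℚᵘ-toℚ n = ℚ.toℚᵘ-fromℚᵘ (mkℚᵘ (+ n) 0)

  toℚ-+ : ∀ m n → toℚ (m ℕ.+ n) ≡ toℚ m + toℚ n
  toℚ-+ m n = ℚ.toℚᵘ-injective (begin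
    ℚ.toℚᵘ (toℚ (m ℕ.+ n))               ≈⟨ toℚᵘ-toℚ (m ℕ.+ n) ⟩
    mkℚᵘ (+ m ℤ.+ + n) 0                 ≈⟨ *≡* (cross-multiply (+ m) (+ n)) ⟩
    mkℚᵘ (+ m) 0 ℚᵘ.+ mkℚᵘ (+ n) 0        ≈⟨ ℚᵘ.+-cong (toℚᵘ-toℚ m) (toℚᵘ-toℚ n) ⟨
    ℚ.toℚᵘ (toℚ m) ℚᵘ.+ ℚ.toℚᵘ (toℚ n)    ≈⟨ ℚ.toℚᵘ-homo-+ (toℚ m) (toℚ n) ⟨
    ℚ.toℚᵘ (toℚ m + toℚ n)               ∎)
    where
    open ℚᵘ.≃-Reasoning
    cross-multiply : ∀ (i j : ℤ) → (i ℤ.+ j) ℤ.* + 1 ≡ (i ℤ.* + 1 ℤ.+ j ℤ.* + 1) ℤ.* + 1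
    cross-multiply = ℤ-Solver.solve-∀

  toℚ-* : ∀ m n → toℚ (m ℕ.* n) ≡ toℚ m * toℚ n
  toℚ-* m n = ℚ.toℚᵘ-injective (begin
    ℚ.toℚᵘ (toℚ (m ℕ.* n))               ≈⟨ toℚᵘ-toℚ (m ℕ.* n) ⟩
    mkℚᵘ (+ (m ℕ.* n)) 0                 ≈⟨ *≡* (cong (ℤ._* + 1) (ℤ.pos-* m n)) ⟩
    mkℚᵘ (+ m) 0 ℚᵘ.* mkℚᵘ (+ n) 0        ≈⟨ ℚᵘ.*-cong (toℚᵘ-toℚ m) (toℚᵘ-toℚ n) ⟨
    ℚ.toℚᵘ (toℚ m) ℚᵘ.* ℚ.toℚᵘ (toℚ n)    ≈⟨ ℚ.toℚᵘ-homo-* (toℚ m) (toℚ n) ⟨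
    ℚ.toℚᵘ (toℚ m * toℚ n)               ∎)
    where open ℚᵘ.≃-Reasoning

  toℚ-mono-≤ : ∀ {m n} → m ℕ.≤ n → toℚ m ≤ toℚ n
  toℚ-mono-≤ {m} {n} m≤n = ℚ.toℚᵘ-cancel-≤ (begin
    ℚ.toℚᵘ (toℚ m)   ≃⟨ toℚᵘ-toℚ m ⟩
    mkℚᵘ (+ m) 0     ≤⟨ *≤* (ℤ.*-monoʳ-≤-nonNeg (+ 1) (ℤ.+≤+ m≤n)) ⟩
    mkℚᵘ (+ n) 0     ≃⟨ toℚᵘ-toℚ n ⟨
    ℚ.toℚᵘ (toℚ n)   ∎)
    where open ℚᵘ.≤-Reasoning

  toℚ-mono-< : ∀ {m n} → m ℕ.< n → toℚ m < toℚ n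
  toℚ-mono-< {m} {n} m<n = ℚ.toℚᵘ-cancel-< (begin-strict
    ℚ.toℚᵘ (toℚ m)   ≃⟨ toℚᵘ-toℚ m ⟩
    mkℚᵘ (+ m) 0     <⟨ *<* (ℤ.*-monoʳ-<-pos (+ 1) (ℤ.+<+ m<n)) ⟩
    mkℚᵘ (+ n) 0     ≃⟨ toℚᵘ-toℚ n ⟨
    ℚ.toℚᵘ (toℚ n)   ∎)
    where open ℚᵘ.≤-Reasoning

  toℚ-cancel-≤ : ∀ {m n} → toℚ m ≤ toℚ n → m ℕ.≤ n
  toℚ-cancel-≤ m≤n = ℕ.≮⇒≥ λ n<m → ℚ.<-irrefl refl (ℚ.≤-<-trans m≤n (toℚ-mono-< n<m))

  toℚ-cancel-< : ∀ {m n} → toℚ m < toℚ n → m ℕ.< n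
  toℚ-cancel-< m<n = ℕ.≰⇒> λ n≤m → ℚ.<-irrefl refl (ℚ.<-≤-trans m<n (toℚ-mono-≤ n≤m))

  +[2n]/2≡toℚn : ∀ n → + (2 ℕ.* n) / 2 ≡ toℚ n
  +[2n]/2≡toℚn n = ℚ.toℚᵘ-injective (begin
    ℚ.toℚᵘ (+ (2 ℕ.* n) / 2)   ≈⟨ ℚ.toℚᵘ-fromℚᵘ (mkℚᵘ (+ (2 ℕ.* n)) 1) ⟩
    mkℚᵘ (+ (2 ℕ.* n)) 1       ≈⟨ *≡* cross-multiply ⟩
    mkℚᵘ (+ n) 0               ≈⟨ toℚᵘ-toℚ n ⟨
    ℚ.toℚᵘ (toℚ n)             ∎)
    where
    open ℚᵘ.≃-Reasoning
    cross-multiply : + (2 ℕ.* n) ℤ.* + 1 ≡ + n ℤ.* + 2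
    cross-multiply = trans (sym (ℤ.pos-* (2 ℕ.* n) 1))
      (trans (cong +_ (trans (ℕ.*-identityʳ (2 ℕ.* n)) (ℕ.*-comm 2 n))) (ℤ.pos-* n 2))

  p<q⇒0<q-p : ∀ {p q} → p < q → 0ℚ < q - p
  p<q⇒0<q-p {p} {q} p<q = subst (_< q - p) (ℚ.+-inverseʳ p) (ℚ.+-monoˡ-< (- p) p<q)

  +-cancelˡ-≤ : ∀ r {p q} → r + p ≤ r + q → p ≤ q
  +-cancelˡ-≤ r {p} {q} r+p≤r+q = subst₂ _≤_ (cancel r p) (cancel r q) (ℚ.+-monoʳ-≤ (- r) r+p≤r+q)
    where
    cancel : ∀ r p → - r + (r + p) ≡ p
    cancel = solve-∀ ℚ-ring

  square-increment-≤ : ∀ u ε → 0ℚ ≤ ε → ε ≤ 1ℚ → (u + ε) * (u + ε) ≤ u * u + (u + u + 1ℚ) * ε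
  square-increment-≤ u ε 0≤ε ε≤1 = begin
    (u + ε) * (u + ε)             ≡⟨ expand u ε ⟩
    u * u + (u + u) * ε + ε * ε   ≤⟨ ℚ.+-monoʳ-≤ (u * u + (u + u) * ε) ε²≤ε ⟩
    u * u + (u + u) * ε + ε       ≡⟨ regroup u ε ⟩
    u * u + (u + u + 1ℚ) * ε      ∎
    where
    open ℚ.≤-Reasoning
    expand : ∀ u ε → (u + ε) * (u + ε) ≡ u * u + (u + u) * ε + ε * ε
    expand = solve-∀ ℚ-ring
    regroup : ∀ u ε → u * u + (u + u) * ε + ε ≡ u * u + (u + u + 1ℚ) * ε
    regroup = solve-∀ ℚ-ring
    ε²≤ε : ε * ε ≤ ε
    ε²≤ε = subst (ε * ε ≤_) (ℚ.*-identityʳ ε) (ℚ.*-monoˡ-≤-nonNeg ε {{ℚ.nonNegative 0≤ε}} ε≤1)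

  positive-step : ∀ w D → 1ℚ ≤ w → 0ℚ < D → Σ ℚ λ ε → 0ℚ < ε × ε ≤ 1ℚ × w * ε ≤ D
  positive-step w D 1≤w 0<D = ε , ℚ.positive⁻¹ ε , ε≤1 , subst (_≤ D) (sym wε≡m) (ℚ.p⊓q≤q 1ℚ D)
    where
    m : ℚ
    m = 1ℚ ⊓ D
    0<m : 0ℚ < m
    0<m with ℚ.⊓-sel 1ℚ D
    ... | inj₁ m≡1 = subst (0ℚ <_) (sym m≡1) (ℚ.positive⁻¹ 1ℚ)
    ... | inj₂ m≡D = subst (0ℚ <_) (sym m≡D) 0<D
    instance
      w>0 : Positive w
      w>0 = positive (ℚ.<-≤-trans (ℚ.positive⁻¹ 1ℚ) 1≤w)
      w≢0 : NonZero w
      w≢0 = ℚ.pos⇒nonZero w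
      1/w>0 : Positive (1/ w)
      1/w>0 = ℚ.1/pos⇒pos w
      m>0 : Positive m
      m>0 = positive 0<m
    ε : ℚ
    ε = m * 1/ w
    instance
      ε>0 : Positive ε
      ε>0 = ℚ.pos*pos⇒pos m (1/ w)
    wε≡m : w * ε ≡ m
    wε≡m = begin-equality
      w * (m * 1/ w)   ≡⟨ reassoc w m (1/ w) ⟩
      m * (w * 1/ w)   ≡⟨ cong (m *_) (ℚ.*-inverseʳ w) ⟩
      m * 1ℚ           ≡⟨ ℚ.*-identityʳ m ⟩
      m                ∎
      where
      open ℚ.≤-Reasoning
      reassoc : ∀ a b c → a * (b * c) ≡ b * (a * c)
      reassoc = solve-∀ ℚ-ring
    ε≤1 : ε ≤ 1ℚ
    ε≤1 = begin
      ε         ≡⟨ ℚ.*-identityˡ ε ⟨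
      1ℚ * ε    ≤⟨ ℚ.*-monoʳ-≤-nonNeg ε {{ℚ.pos⇒nonNeg ε}} 1≤w ⟩
      w * ε     ≡⟨ wε≡m ⟩
      m         ≤⟨ ℚ.p⊓q≤p 1ℚ D ⟩
      1ℚ        ∎
      where open ℚ.≤-Reasoning

  larger-square-below : ∀ u y → 0ℚ ≤ u → u * u < y → Σ ℚ λ c → u < c × c * c ≤ y
  larger-square-below u y 0≤u u²<y =
    let ε , 0<ε , ε≤1 , wε≤y-u² = positive-step (u + u + 1ℚ) (y - u * u) 1≤w (p<q⇒0<q-p u²<y)
    in u + ε , subst (_< u + ε) (ℚ.+-identityʳ u) (ℚ.+-monoʳ-< u 0<ε) , (begin
      (u + ε) * (u + ε)          ≤⟨ square-increment-≤ u ε (ℚ.<⇒≤ 0<ε) ε≤1 ⟩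
      u * u + (u + u + 1ℚ) * ε   ≤⟨ ℚ.+-monoʳ-≤ (u * u) wε≤y-u² ⟩
      u * u + (y - u * u)        ≡⟨ cancel u y ⟩
      y                          ∎)
    where
    open ℚ.≤-Reasoning
    1≤w : 1ℚ ≤ u + u + 1ℚ
    1≤w = ℚ.+-monoˡ-≤ 1ℚ (ℚ.+-mono-≤ 0≤u 0≤u)
    cancel : ∀ u y → u * u + (y - u * u) ≡ y
    cancel = solve-∀ ℚ-ring

  root-above : ∀ r Q → toℚ (r ℕ.* r) < toℚ r + Q →
    Σ ℚ λ c → 0ℚ ≤ c × c * c ≤ Q + ¼ × toℚ r < c + ½
  root-above zero Q 0<Q =
    0ℚ , ℚ.≤-refl , ℚ.+-mono-≤ (ℚ.<⇒≤ (subst (0ℚ <_) (ℚ.+-identityˡ Q) 0<Q)) (ℚ.nonNegative⁻¹ ¼) ,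
    ℚ.positive⁻¹ ½
  root-above (suc r) Q R²<R+Q =
    let c , u<c , c²≤Q+¼ = larger-square-below (s + ½) (Q + ¼) 0≤s+½ u²<Q+¼
    in c , ℚ.<⇒≤ (ℚ.≤-<-trans 0≤s+½ u<c) , c²≤Q+¼ ,
       subst (_< c + ½) (sym R≡s+½+½) (ℚ.+-monoˡ-< ½ u<c)
    where
    s : ℚ
    s = toℚ r
    R≡1+s : toℚ (suc r) ≡ 1ℚ + s
    R≡1+s = toℚ-+ 1 r
    R≡s+½+½ : toℚ (suc r) ≡ s + ½ + ½
    R≡s+½+½ = trans R≡1+s (halves s)
      where
      halves : ∀ s → 1ℚ + s ≡ s + ½ + ½
      halves = solve-∀ ℚ-ring
    0≤s+½ : 0ℚ ≤ s + ½
    0≤s+½ = ℚ.+-mono-≤ (toℚ-mono-≤ {0} {r} ℕ.z≤n) (ℚ.nonNegative⁻¹ ½)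
    u²<Q+¼ : (s + ½) * (s + ½) < Q + ¼
    u²<Q+¼ = begin-strict
      (s + ½) * (s + ½)                       ≡⟨ complete-square s ⟩
      (1ℚ + s) * (1ℚ + s) + (¼ - (1ℚ + s))    ≡⟨ cong (_+ (¼ - (1ℚ + s))) R²≡ ⟨
      toℚ (suc r ℕ.* suc r) + (¼ - (1ℚ + s))  <⟨ ℚ.+-monoˡ-< (¼ - (1ℚ + s)) R²<R+Q ⟩
      toℚ (suc r) + Q + (¼ - (1ℚ + s))        ≡⟨ cong (λ R → R + Q + (¼ - (1ℚ + s))) R≡1+s ⟩
      1ℚ + s + Q + (¼ - (1ℚ + s))             ≡⟨ cancel s Q ⟩
      Q + ¼                                   ∎
      where
      open ℚ.≤-Reasoning
      R²≡ : toℚ (suc r ℕ.* suc r) ≡ (1ℚ + s) * (1ℚ + s)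
      R²≡ = trans (toℚ-* (suc r) (suc r)) (cong₂ _*_ R≡1+s R≡1+s)
      complete-square : ∀ s → (s + ½) * (s + ½) ≡ (1ℚ + s) * (1ℚ + s) + (¼ - (1ℚ + s))
      complete-square = solve-∀ ℚ-ring
      cancel : ∀ s Q → 1ℚ + s + Q + (¼ - (1ℚ + s)) ≡ Q + ¼
      cancel = solve-∀ ℚ-ring

  -- The cut form of f_{k+1}(x)² − f_{k+1}(x) = 2x f_k(x).
  FBound-unfold : ∀ j x r p → FBound (4 ℕ.+ j) x (toℚ r) → LowerF j x p →
    toℚ r + toℚ 2 * toℚ x * p ≤ toℚ (r ℕ.* r)
  FBound-unfold j x r p bound p∈cut = ℚ.≮⇒≥ λ r²<r+2xp →
    let c , 0≤c , c²≤ , r<c+½ = root-above r (toℚ 2 * toℚ x * p) r²<r+2xp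
        c+½≤r = bound (c + ½) (p , c , p∈cut , 0≤c , c²≤ , ℚ.≤-refl)
    in ℚ.<-irrefl refl (ℚ.<-≤-trans r<c+½ c+½≤r)

  lowerF₃ : ∀ N t → 1 ℕ.≤ N → t ℕ.* t ℕ.≤ N → LowerF 0 (2 ℕ.* N) (toℚ t + 1ℚ + ½)
  lowerF₃ N t 1≤N t²≤N =
    toℚ t , 1ℚ , toℚ-mono-≤ {0} {t} ℕ.z≤n , ℚ.nonNegative⁻¹ 1ℚ ,
    subst₂ _≤_ (toℚ-* t t) (sym (+[2n]/2≡toℚn N)) (toℚ-mono-≤ t²≤N) ,
    subst (1ℚ * 1ℚ * 1ℚ * 1ℚ ≤_) (sym (+[2n]/2≡toℚn N)) (toℚ-mono-≤ {1} {N} 1≤N) ,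
    ℚ.≤-refl

  FBound₃⇒3≤ : ∀ N r → 1 ℕ.≤ N → FBound 3 (2 ℕ.* N) (toℚ r) → 3 ℕ.≤ r
  FBound₃⇒3≤ N r 1≤N bound =
    toℚ-cancel-< (ℚ.<-≤-trans (toWitness {a? = toℚ 2 ℚ.<? toℚ 1 + 1ℚ + ½} _)
                              (bound _ (lowerF₃ N 1 1≤N 1≤N)))

  FBound₄⇒ : ∀ N t r → 1 ℕ.≤ N → t ℕ.* t ℕ.≤ N → FBound 4 (2 ℕ.* N) (toℚ r) →
    r ℕ.+ 2 ℕ.* N ℕ.* (2 ℕ.* t ℕ.+ 3) ℕ.≤ r ℕ.* r
  FBound₄⇒ N t r 1≤N t²≤N bound = toℚ-cancel-≤ (begin
    toℚ (r ℕ.+ 2 ℕ.* N ℕ.* (2 ℕ.* t ℕ.+ 3))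
      ≡⟨ toℚ-+ r _ ⟩
    toℚ r + toℚ (2 ℕ.* N ℕ.* (2 ℕ.* t ℕ.+ 3))
      ≡⟨ cong (λ z → toℚ r + z) (toℚ-* (2 ℕ.* N) _) ⟩
    toℚ r + toℚ (2 ℕ.* N) * toℚ (2 ℕ.* t ℕ.+ 3)
      ≡⟨ cong (λ z → toℚ r + toℚ (2 ℕ.* N) * z) (trans (toℚ-+ (2 ℕ.* t) 3) (cong (_+ toℚ 3) (toℚ-* 2 t))) ⟩
    toℚ r + toℚ (2 ℕ.* N) * (toℚ 2 * toℚ t + toℚ 3)
      ≡⟨ regroup (toℚ r) (toℚ (2 ℕ.* N)) (toℚ t) ⟩
    toℚ r + toℚ 2 * toℚ (2 ℕ.* N) * (toℚ t + 1ℚ + ½)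
      ≤⟨ FBound-unfold 0 (2 ℕ.* N) r _ bound (lowerF₃ N t 1≤N t²≤N) ⟩
    toℚ (r ℕ.* r)
      ∎)
    where
    open ℚ.≤-Reasoning
    regroup : ∀ r x t → r + x * (toℚ 2 * t + toℚ 3) ≡ r + toℚ 2 * x * (t + 1ℚ + ½)
    regroup = solve-∀ ℚ-ring

  FBound-descend : ∀ j x r s → 1 ℕ.≤ x → FBound (5 ℕ.+ j) x (toℚ r) →
    r ℕ.* r ℕ.≤ r ℕ.+ 2 ℕ.* x ℕ.* s → FBound (4 ℕ.+ j) x (toℚ s)
  FBound-descend j x r s 1≤x bound r²≤r+2xs q q∈cut =
    ℚ.*-cancelˡ-≤-pos (toℚ 2 * toℚ x) {{2x>0}} (+-cancelˡ-≤ (toℚ r) (begin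
      toℚ r + toℚ 2 * toℚ x * q       ≤⟨ FBound-unfold (suc j) x r q bound q∈cut ⟩
      toℚ (r ℕ.* r)                   ≤⟨ toℚ-mono-≤ r²≤r+2xs ⟩
      toℚ (r ℕ.+ 2 ℕ.* x ℕ.* s)       ≡⟨ toℚ-expand ⟩
      toℚ r + toℚ 2 * toℚ x * toℚ s   ∎))
    where
    open ℚ.≤-Reasoning
    2x>0 : Positive (toℚ 2 * toℚ x)
    2x>0 = positive (subst (0ℚ <_) (toℚ-* 2 x) (toℚ-mono-< (ℕ.*-monoʳ-< 2 1≤x)))
    toℚ-expand : toℚ (r ℕ.+ 2 ℕ.* x ℕ.* s) ≡ toℚ r + toℚ 2 * toℚ x * toℚ s
    toℚ-expand = trans (toℚ-+ r _)
      (cong (λ z → toℚ r + z) (trans (toℚ-* (2 ℕ.* x) s) (cong (_* toℚ s) (toℚ-* 2 x))))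

open import Data.Bool.Base as Bool using (Bool; true; false; not)
import Data.Bool.Properties as Bool
open import Data.Empty using (⊥; ⊥-elim)
open import Data.Fin.Base as Fin using (Fin; zero; suc; fromℕ)
import Data.Fin.Properties as Fin
open import Data.Integer.Base as ℤ using (ℤ; +_)
import Data.Integer.Properties as ℤ
open import Data.Integer.Tactic.RingSolver as ℤ-Solver using ()
open import Algebra.Properties.Ring ℤ.+-*-ring using (+-identityʳ-unique)
open import Data.List.Base using (List; []; _∷_; length; filter; tabulate)
import Data.List.Properties as List
open import Data.List.Membership.Propositional using (_∈_; _∉_)
open import Data.List.Membership.Propositional.Properties using (∈-filter⁻; ∈-tabulate⁻)
open import Data.List.Relation.Binary.Subset.Propositional using (_⊆_)
import Data.List.Relation.Binary.Sublist.Propositional as Sublist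
import Data.List.Relation.Binary.Sublist.Propositional.Properties as Sublist
open import Data.List.Relation.Unary.All as All using (All; []; _∷_)
open import Data.List.Relation.Unary.AllPairs using (AllPairs; []; _∷_)
import Data.List.Relation.Unary.AllPairs.Properties as AllPairs
open import Data.List.Relation.Unary.Any using (here; there)
open import Data.Nat.Base using (ℕ; zero; suc; _+_; _*_; _∸_; _≤_; _<_; z≤n; s≤s; _/_; NonZero; >-nonZero)
open import Data.Nat.Divisibility using (_∣_)
import Data.Nat.DivMod as DivMod
import Data.Nat.Properties as ℕ
open import Data.List.Membership.DecPropositional ℕ._≟_ using (_∈?_)
open import Data.Nat.Tactic.RingSolver using (solve-∀)
open import Data.Product.Base using (Σ; ∃-syntax; _×_; _,_; proj₁; proj₂)
open import Function.Base using (_∘_)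
open import Function.Definitions using (Injective)
open import Relation.Binary.PropositionalEquality
open import Relation.Nullary.Decidable using (Dec; yes; no)
open import Relation.Unary using (Pred; Decidable)

open CutBounds using (FBound₃⇒3≤; FBound₄⇒; FBound-descend)

n+n≡2*n : ∀ n → n + n ≡ 2 * n
n+n≡2*n = solve-∀

∑[1‥_] : ℕ → (ℕ → ℕ) → ℕ
∑[1‥ zero  ] f = 0
∑[1‥ suc N ] f = ∑[1‥ N ] f + f (suc N)

∑-mono-≤ : ∀ N {f g} → (∀ d → f d ≤ g d) → ∑[1‥ N ] f ≤ ∑[1‥ N ] g
∑-mono-≤ zero    f≤g = z≤n
∑-mono-≤ (suc N) f≤g = ℕ.+-mono-≤ (∑-mono-≤ N f≤g) (f≤g (suc N))

∑-+ : ∀ N f g → ∑[1‥ N ] (λ d → f d + g d) ≡ ∑[1‥ N ] f + ∑[1‥ N ] g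
∑-+ zero    f g = refl
∑-+ (suc N) f g = trans (cong (_+ (f (suc N) + g (suc N))) (∑-+ N f g))
                        (interchange (∑[1‥ N ] f) (∑[1‥ N ] g) (f (suc N)) (g (suc N)))
  where
  interchange : ∀ a b c d → (a + b) + (c + d) ≡ (a + c) + (b + d)
  interchange = solve-∀

∑-term : ∀ N f {d} → 1 ≤ d → d ≤ N → f d ≤ ∑[1‥ N ] f
∑-term zero    f (s≤s _) ()
∑-term (suc N) f {d} 1≤d d≤1+N with d ℕ.≟ suc N
... | yes refl   = ℕ.m≤n+m (f (suc N)) (∑[1‥ N ] f)
... | no d≢1+N = ℕ.≤-trans (∑-term N f 1≤d (ℕ.≤-pred (ℕ.≤∧≢⇒< d≤1+N d≢1+N))) (ℕ.m≤m+n _ _)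

pigeonhole : ∀ N f → 1 ≤ N → ∃[ d ] 1 ≤ d × d ≤ N × ∑[1‥ N ] f ≤ N * f d
pigeonhole (suc zero)    f _ = 1 , ℕ.≤-refl , ℕ.≤-refl , ℕ.≤-reflexive (sym (ℕ.+-identityʳ (f 1)))
pigeonhole (suc (suc N)) f _ with pigeonhole (suc N) f (s≤s z≤n)
... | d , 1≤d , d≤1+N , ∑≤ with f (suc (suc N)) ℕ.≤? f d
...   | yes f[2+N]≤f[d] = d , 1≤d , ℕ.m≤n⇒m≤1+n d≤1+N , ℕ.≤-trans
          (ℕ.+-mono-≤ ∑≤ f[2+N]≤f[d]) (ℕ.≤-reflexive (ℕ.+-comm (suc N * f d) (f d)))
...   | no f[2+N]≰f[d] = suc (suc N) , s≤s z≤n , ℕ.≤-refl , ℕ.≤-trans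
          (ℕ.+-monoˡ-≤ _ (ℕ.≤-trans ∑≤ (ℕ.*-monoʳ-≤ (suc N) (ℕ.<⇒≤ (ℕ.≰⇒> f[2+N]≰f[d])))))
          (ℕ.≤-reflexive (ℕ.+-comm (suc N * f (suc (suc N))) _))

pigeonhole₂ : ∀ N f → N < ∑[1‥ N ] f → ∃[ d ] 1 ≤ d × d ≤ N × 2 ≤ f d
pigeonhole₂ zero    f ()
pigeonhole₂ (suc N) f N<∑ =
  let d , 1≤d , d≤N , ∑≤ = pigeonhole (suc N) f (s≤s z≤n)
  in d , 1≤d , d≤N , ℕ.≰⇒> λ f[d]≤1 → ℕ.<-irrefl refl (begin-strict
       suc N              <⟨ N<∑ ⟩
       ∑[1‥ suc N ] f     ≤⟨ ∑≤ ⟩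
       suc N * f d        ≤⟨ ℕ.*-monoʳ-≤ (suc N) f[d]≤1 ⟩
       suc N * 1          ≡⟨ ℕ.*-identityʳ (suc N) ⟩
       suc N              ∎)
  where open ℕ.≤-Reasoning

pigeonhole-except : ∀ N δ f → N + f δ < ∑[1‥ N ] f → ∃[ d ] 1 ≤ d × d ≤ N × d ≢ δ × 2 ≤ f d
pigeonhole-except zero    δ f ()
pigeonhole-except (suc N) δ f hyp with suc N ℕ.≟ δ
... | yes refl =
  let d , 1≤d , d≤N , 2≤f[d] = pigeonhole₂ N f N<∑
  in d , 1≤d , ℕ.m≤n⇒m≤1+n d≤N , (λ d≡1+N → ℕ.<-irrefl refl (subst (_≤ N) d≡1+N d≤N)) , 2≤f[d]
  where
  N<∑ : N < ∑[1‥ N ] f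
  N<∑ = ℕ.<-trans (ℕ.n<1+n N) (ℕ.+-cancelʳ-< (f (suc N)) (suc N) _ hyp)
... | no 1+N≢δ with 2 ℕ.≤? f (suc N)
...   | yes 2≤f[1+N] = suc N , s≤s z≤n , ℕ.≤-refl , 1+N≢δ , 2≤f[1+N]
...   | no 2≰f[1+N] =
  let d , 1≤d , d≤N , d≢δ , 2≤f[d] = pigeonhole-except N δ f N+f[δ]<∑
  in d , 1≤d , ℕ.m≤n⇒m≤1+n d≤N , d≢δ , 2≤f[d]
  where
  N+f[δ]<∑ : N + f δ < ∑[1‥ N ] f
  N+f[δ]<∑ = ℕ.+-cancelʳ-< 1 (N + f δ) _ (begin-strict
    N + f δ + 1             ≡⟨ ℕ.+-comm (N + f δ) 1 ⟩
    suc N + f δ             <⟨ hyp ⟩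
    ∑[1‥ N ] f + f (suc N)  ≤⟨ ℕ.+-monoʳ-≤ (∑[1‥ N ] f) (ℕ.≤-pred (ℕ.≰⇒> 2≰f[1+N])) ⟩
    ∑[1‥ N ] f + 1          ∎)
    where open ℕ.≤-Reasoning

𝟙 : ∀ {p} {P : Set p} → Dec P → ℕ
𝟙 (yes _) = 1
𝟙 (no _)  = 0

𝟙-yes : ∀ {p} {P : Set p} → P → (P? : Dec P) → 𝟙 P? ≡ 1
𝟙-yes p (yes _) = refl
𝟙-yes p (no ¬p) = ⊥-elim (¬p p)

𝟙-mono : ∀ {p q} {P : Set p} {Q : Set q} → (P → Q) → (P? : Dec P) (Q? : Dec Q) → 𝟙 P? ≤ 𝟙 Q?
𝟙-mono P⇒Q (yes _) (yes _) = ℕ.≤-refl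
𝟙-mono P⇒Q (yes p) (no ¬q) = ⊥-elim (¬q (P⇒Q p))
𝟙-mono P⇒Q (no _)  _       = z≤n

𝟙-∈-∷ : ∀ {w C} y → w ∉ C → 𝟙 (y ℕ.≟ w) + 𝟙 (y ∈? C) ≤ 𝟙 (y ∈? w ∷ C)
𝟙-∈-∷ {w} {C} y w∉C with y ℕ.≟ w | y ∈? C | y ∈? w ∷ C
... | yes refl | yes y∈C | _        = ⊥-elim (w∉C y∈C)
... | yes _    | no _    | yes _    = ℕ.≤-refl
... | yes y≡w  | no _    | no y∉w∷C = ⊥-elim (y∉w∷C (here y≡w))
... | no _     | yes _   | yes _    = ℕ.≤-refl
... | no _     | yes y∈C | no y∉w∷C = ⊥-elim (y∉w∷C (there y∈C))
... | no _     | no _    | _        = z≤n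

module _ {a p} {A : Set a} {P : Pred A p} (P? : Decidable P) where

  length-filter-∷ : ∀ x xs → length (filter P? (x ∷ xs)) ≡ 𝟙 (P? x) + length (filter P? xs)
  length-filter-∷ x xs with P? x
  ... | yes _ = refl
  ... | no _  = refl

  length-filter-mono : ∀ {q} {Q : Pred A q} (Q? : Decidable Q) → (∀ {x} → P x → Q x) →
    ∀ xs → length (filter P? xs) ≤ length (filter Q? xs)
  length-filter-mono Q? P⇒Q xs =
    Sublist.length-mono-≤ (Sublist.filter⁺ P? Q? (λ { refl → P⇒Q }) (Sublist.⊆-refl {x = xs}))

Sorted : List ℕ → Set
Sorted = AllPairs _<_

Spread≤ : ℕ → List ℕ → Set
Spread≤ N C = ∀ {v w} → v ∈ C → w ∈ C → w ≤ v + N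

Spread≤-⊆ : ∀ {N T C} → T ⊆ C → Spread≤ N C → Spread≤ N T
Spread≤-⊆ T⊆C spread v∈T w∈T = spread (T⊆C v∈T) (T⊆C w∈T)

sorted-pair : ∀ L → Sorted L → 2 ≤ length L → ∃[ v ] ∃[ w ] v < w × v ∈ L × w ∈ L
sorted-pair (v ∷ w ∷ L) ((v<w ∷ _) ∷ _) _         = v , w , v<w , here refl , there (here refl)
sorted-pair (v ∷ [])    _                 (s≤s ())

gapStarts : ℕ → List ℕ → List ℕ
gapStarts d C = filter (λ v → v + d ∈? C) C

gapStarts-⊆ : ∀ {d C} → gapStarts d C ⊆ C
gapStarts-⊆ {d} {C} = proj₁ ∘ ∈-filter⁻ (λ v → v + d ∈? C) {xs = C}

gapStarts-shift : ∀ {d C c} → c ∈ gapStarts d C → c + d ∈ C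
gapStarts-shift {d} {C} = proj₂ ∘ ∈-filter⁻ (λ v → v + d ∈? C) {xs = C}

gapStarts-sorted : ∀ {d C} → Sorted C → Sorted (gapStarts d C)
gapStarts-sorted {d} {C} = AllPairs.filter⁺ (λ v → v + d ∈? C)

gapStarts-∷ : ∀ d x C → 𝟙 (x + d ∈? C) + length (gapStarts d C) ≤ length (gapStarts d (x ∷ C))
gapStarts-∷ d x C = begin
  𝟙 (x + d ∈? C) + length (filter (λ v → v + d ∈? C) C)
    ≤⟨ ℕ.+-mono-≤ (𝟙-mono there (x + d ∈? C) (x + d ∈? x ∷ C))
                  (length-filter-mono (λ v → v + d ∈? C) (λ v → v + d ∈? x ∷ C) there C) ⟩
  𝟙 (x + d ∈? x ∷ C) + length (filter (λ v → v + d ∈? x ∷ C) C)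
    ≡⟨ length-filter-∷ (λ v → v + d ∈? x ∷ C) x C ⟨
  length (gapStarts d (x ∷ C))
    ∎
  where open ℕ.≤-Reasoning

length≤∑gaps : ∀ x N C → Sorted C → All (λ w → x < w × w ≤ x + N) C →
  length C ≤ ∑[1‥ N ] (λ d → 𝟙 (x + d ∈? C))
length≤∑gaps x N []      []             []                          = z≤n
length≤∑gaps x N (w ∷ C) (w<C ∷ sorted) ((x<w , w≤x+N) ∷ bounds) = begin
  1 + length C
    ≤⟨ ℕ.+-mono-≤ w-x-counted (length≤∑gaps x N C sorted bounds) ⟩
  ∑[1‥ N ] (λ d → 𝟙 (x + d ℕ.≟ w)) + ∑[1‥ N ] (λ d → 𝟙 (x + d ∈? C))
    ≡⟨ ∑-+ N (λ d → 𝟙 (x + d ℕ.≟ w)) (λ d → 𝟙 (x + d ∈? C)) ⟨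
  ∑[1‥ N ] (λ d → 𝟙 (x + d ℕ.≟ w) + 𝟙 (x + d ∈? C))
    ≤⟨ ∑-mono-≤ N (λ d → 𝟙-∈-∷ (x + d) (λ w∈C → ℕ.<-irrefl refl (All.lookup w<C w∈C))) ⟩
  ∑[1‥ N ] (λ d → 𝟙 (x + d ∈? w ∷ C))
    ∎
  where
  open ℕ.≤-Reasoning
  w-x-counted : 1 ≤ ∑[1‥ N ] (λ d → 𝟙 (x + d ℕ.≟ w))
  w-x-counted = subst (_≤ ∑[1‥ N ] (λ d → 𝟙 (x + d ℕ.≟ w)))
    (𝟙-yes (ℕ.m+[n∸m]≡n (ℕ.<⇒≤ x<w)) (x + (w ∸ x) ℕ.≟ w))
    (∑-term N (λ d → 𝟙 (x + d ℕ.≟ w)) (ℕ.m<n⇒0<n∸m x<w)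
       (subst (w ∸ x ≤_) (ℕ.m+n∸m≡n x N) (ℕ.∸-monoˡ-≤ x w≤x+N)))

pair-count : ∀ N C → Sorted C → Spread≤ N C →
  length C * length C ≤ length C + 2 * ∑[1‥ N ] (λ d → length (gapStarts d C))
pair-count N []      []             spread = z≤n
pair-count N (x ∷ C) (x<C ∷ sorted) spread = begin
  suc r * suc r                ≡⟨ square-suc r ⟩
  suc r + r + r * r            ≤⟨ ℕ.+-monoʳ-≤ (suc r + r) (pair-count N C sorted (Spread≤-⊆ there spread)) ⟩
  suc r + r + (r + 2 * s′)     ≡⟨ regroup r s′ ⟩
  suc r + 2 * (r + s′)         ≤⟨ ℕ.+-monoʳ-≤ (suc r) (ℕ.*-monoʳ-≤ 2 r+s′≤s) ⟩
  suc r + 2 * s                ∎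
  where
  open ℕ.≤-Reasoning
  r s s′ : ℕ
  r = length C
  s = ∑[1‥ N ] (λ d → length (gapStarts d (x ∷ C)))
  s′ = ∑[1‥ N ] (λ d → length (gapStarts d C))
  square-suc : ∀ r → suc r * suc r ≡ suc r + r + r * r
  square-suc = solve-∀
  regroup : ∀ r s → suc r + r + (r + 2 * s) ≡ suc r + 2 * (r + s)
  regroup = solve-∀
  bounds : All (λ w → x < w × w ≤ x + N) C
  bounds = All.tabulate λ w∈C → All.lookup x<C w∈C , spread (here refl) (there w∈C)
  r+s′≤s : r + s′ ≤ s
  r+s′≤s = begin
    r + s′
      ≤⟨ ℕ.+-monoˡ-≤ s′ (length≤∑gaps x N C sorted bounds) ⟩
    ∑[1‥ N ] (λ d → 𝟙 (x + d ∈? C)) + s′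
      ≡⟨ ∑-+ N _ _ ⟨
    ∑[1‥ N ] (λ d → 𝟙 (x + d ∈? C) + length (gapStarts d C))
      ≤⟨ ∑-mono-≤ N (λ d → gapStarts-∷ d x C) ⟩
    s
      ∎

popular-gap : ∀ N C → 1 ≤ N → Sorted C → Spread≤ N C →
  ∃[ δ ] 1 ≤ δ × length C * length C ≤ length C + 2 * (N * length (gapStarts δ C))
popular-gap N C 1≤N sorted spread =
  let δ , 1≤δ , _ , ∑≤ = pigeonhole N (λ d → length (gapStarts d C)) 1≤N
  in δ , 1≤δ , ℕ.≤-trans (pair-count N C sorted spread) (ℕ.+-monoʳ-≤ (length C) (ℕ.*-monoʳ-≤ 2 ∑≤))

repeated-gap : ∀ N δ S → Sorted S → Spread≤ N S → 3 * length S + 2 * suc N ≤ length S * length S →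
  ∃[ d ] 1 ≤ d × d ≢ δ × 2 ≤ length (gapStarts d S)
repeated-gap N δ S sorted spread large =
  let d , 1≤d , _ , d≢δ , 2≤F[d] = pigeonhole-except N δ F N+F[δ]<∑F in d , 1≤d , d≢δ , 2≤F[d]
  where
  open ℕ.≤-Reasoning
  s : ℕ
  s = length S
  F : ℕ → ℕ
  F d = length (gapStarts d S)
  regroup : ∀ s N → s + 2 * suc (N + s) ≡ 3 * s + 2 * suc N
  regroup = solve-∀
  F[δ]≤s : F δ ≤ s
  F[δ]≤s = List.length-filter _ S
  N+F[δ]<∑F : N + F δ < ∑[1‥ N ] F
  N+F[δ]<∑F = ℕ.*-cancelˡ-≤ 2 (ℕ.+-cancelˡ-≤ s _ _ (begin
    s + 2 * suc (N + F δ)      ≤⟨ ℕ.+-monoʳ-≤ s (ℕ.*-monoʳ-≤ 2 (s≤s (ℕ.+-monoʳ-≤ N F[δ]≤s))) ⟩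
    s + 2 * suc (N + s)        ≡⟨ regroup s N ⟩
    3 * s + 2 * suc N          ≤⟨ large ⟩
    s * s                      ≤⟨ pair-count N S sorted spread ⟩
    s + 2 * ∑[1‥ N ] F         ∎))

GapFree : ℕ → List ℕ → Set
GapFree d T = ∀ {c} → c ∈ T → c + d ∉ T

even : ℕ → Bool
even zero    = true
even (suc n) = not (even n)

colourClass : (ℕ → Bool) → Bool → List ℕ → List ℕ
colourClass χ β = filter (λ c → χ c Bool.≟ β)

length-colourClasses : ∀ χ S → length (colourClass χ true S) + length (colourClass χ false S) ≡ length S
length-colourClasses χ []      = refl
length-colourClasses χ (x ∷ S) with χ x
... | true  = cong suc (length-colourClasses χ S)
... | false = trans (ℕ.+-suc _ _) (cong suc (length-colourClasses χ S))

colourClass-gapFree : ∀ d χ → (∀ c → χ (c + d) ≡ not (χ c)) → ∀ β S → GapFree d (colourClass χ β S)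
colourClass-gapFree d χ flips β S {c} c∈ c+d∈ = Bool.not-¬ χ[c+d]≡β (trans (flips c) (cong not χ[c]≡β))
  where
  χ[c]≡β : χ c ≡ β
  χ[c]≡β = proj₂ (∈-filter⁻ (λ c → χ c Bool.≟ β) {xs = S} c∈)
  χ[c+d]≡β : χ (c + d) ≡ β
  χ[c+d]≡β = proj₂ (∈-filter⁻ (λ c → χ c Bool.≟ β) {xs = S} c+d∈)

-- Colour c by the parity of ⌊c / d⌋; then c and c + d always get different colours.
halve : ∀ d .{{_ : NonZero d}} S → Sorted S →
  ∃[ T ] T ⊆ S × Sorted T × length S ≤ 2 * length T × GapFree d T
halve d S sorted = pick (length (class true) ℕ.≤? length (class false))
  where
  χ : ℕ → Bool
  χ c = even (c / d)
  flips : ∀ c → χ (c + d) ≡ not (χ c)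
  flips c = cong even (trans (DivMod.m/n≡1+[m∸n]/n (ℕ.m≤n+m d c))
                             (cong (λ m → suc (m / d)) (ℕ.m+n∸n≡m c d)))
  class : Bool → List ℕ
  class β = colourClass χ β S
  choose : ∀ β → length S ≤ 2 * length (class β) →
    ∃[ T ] T ⊆ S × Sorted T × length S ≤ 2 * length T × GapFree d T
  choose β large =
    class β , proj₁ ∘ ∈-filter⁻ (λ c → χ c Bool.≟ β) {xs = S} , AllPairs.filter⁺ _ sorted , large ,
    colourClass-gapFree d χ flips β S
  pick : Dec (length (class true) ≤ length (class false)) →
    ∃[ T ] T ⊆ S × Sorted T × length S ≤ 2 * length T × GapFree d T
  pick (yes t≤f) = choose false (subst₂ _≤_ (length-colourClasses χ S) (n+n≡2*n (length (class false)))
    (ℕ.+-monoˡ-≤ (length (class false)) t≤f))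
  pick (no t≰f)  = choose true (subst₂ _≤_ (length-colourClasses χ S) (n+n≡2*n (length (class true)))
    (ℕ.+-monoʳ-≤ (length (class true)) (ℕ.<⇒≤ (ℕ.≰⇒> t≰f))))

double : ℕ → ℤ
double c = + c ℤ.+ + c

double-injective : ∀ {m n} → double m ≡ double n → m ≡ n
double-injective {m} {n} 2m≡2n = ℕ.*-cancelˡ-≡ m n 2 (begin
  2 * m    ≡⟨ n+n≡2*n m ⟨
  m + m    ≡⟨ ℤ.+-injective 2m≡2n ⟩
  n + n    ≡⟨ n+n≡2*n n ⟩
  2 * n    ∎)
  where open ≡-Reasoning

record PairSum (C : List ℕ) (x y : ℤ) : Set where
  constructor withMidpoint
  field
    midpoint  : ℕ
    midpoint∈ : midpoint ∈ C
    sum≡      : x ℤ.+ y ≡ double midpoint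

record SumConfig (k : ℕ) (C : List ℕ) : Set where
  field
    b         : Fin k → ℤ
    injective : Injective _≡_ _≡_ b
    pairSum   : ∀ {i j} → i ≢ j → PairSum C (b i) (b j)

record AnchoredConfig (k : ℕ) (C : List ℕ) : Set where
  field
    config : SumConfig k C
    anchor : Fin k
  open SumConfig config public
  field
    anchorSum : PairSum C (b anchor) (b anchor)

pairSum-comm : ∀ {C x y} → PairSum C x y → PairSum C y x
pairSum-comm {x = x} {y} (withMidpoint c c∈C x+y≡2c) = withMidpoint c c∈C (trans (ℤ.+-comm y x) x+y≡2c)

pairSum-⊆ : ∀ {T C x y} → T ⊆ C → PairSum T x y → PairSum C x y
pairSum-⊆ T⊆C (withMidpoint c c∈T x+y≡2c) = withMidpoint c (T⊆C c∈T) x+y≡2c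

double-+ : ∀ c δ → double c ℤ.+ double δ ≡ double (c + δ)
double-+ c δ = interchange (+ c) (+ δ)
  where
  interchange : ∀ c d → c ℤ.+ c ℤ.+ (d ℤ.+ d) ≡ (c ℤ.+ d) ℤ.+ (c ℤ.+ d)
  interchange = ℤ-Solver.solve-∀

pairSum-shift : ∀ {T C δ x y} → (∀ {c} → c ∈ T → c + δ ∈ C) →
  PairSum T x y → PairSum C (x ℤ.+ double δ) y
pairSum-shift {δ = δ} {x} {y} shift (withMidpoint c c∈T x+y≡2c) = withMidpoint (c + δ) (shift c∈T) (begin
  x ℤ.+ double δ ℤ.+ y       ≡⟨ swap x (double δ) y ⟩
  x ℤ.+ y ℤ.+ double δ       ≡⟨ cong (ℤ._+ double δ) x+y≡2c ⟩
  double c ℤ.+ double δ      ≡⟨ double-+ c δ ⟩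
  double (c + δ)             ∎)
  where
  open ≡-Reasoning
  swap : ∀ x d y → x ℤ.+ d ℤ.+ y ≡ x ℤ.+ y ℤ.+ d
  swap = ℤ-Solver.solve-∀

-- Thanks to the anchor, b anchor + b j = 2c with c ∈ T for every j (also j = anchor),
-- so the new element b anchor + 2δ pairs with b j to 2(c + δ).
extend : ∀ {k δ T C} → T ⊆ C → (∀ {c} → c ∈ T → c + δ ∈ C) → (A : AnchoredConfig k T) →
  (let open AnchoredConfig A in ∀ i → b i ≢ b anchor ℤ.+ double δ) →
  AnchoredConfig (suc k) C
extend {k} {δ} {T} {C} T⊆C shift A noCollision = record
  { config    = record { b = b′ ; injective = injective′ ; pairSum = pairSum′ }
  ; anchor    = suc anchor
  ; anchorSum = pairSum-⊆ T⊆C anchorSum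
  }
  where
  open AnchoredConfig A
  b′ : Fin (suc k) → ℤ
  b′ zero    = b anchor ℤ.+ double δ
  b′ (suc i) = b i
  withAnchor : ∀ j → PairSum T (b anchor) (b j)
  withAnchor j with j Fin.≟ anchor
  ... | yes refl = anchorSum
  ... | no j≢a   = pairSum (j≢a ∘ sym)
  injective′ : Injective _≡_ _≡_ b′
  injective′ {zero}  {zero}  _ = refl
  injective′ {zero}  {suc j} e = ⊥-elim (noCollision j (sym e))
  injective′ {suc i} {zero}  e = ⊥-elim (noCollision i e)
  injective′ {suc i} {suc j} e = cong suc (injective e)
  pairSum′ : ∀ {i j} → i ≢ j → PairSum C (b′ i) (b′ j)
  pairSum′ {zero}  {zero}  0≢0 = ⊥-elim (0≢0 refl)
  pairSum′ {zero}  {suc j} _   = pairSum-shift shift (withAnchor j)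
  pairSum′ {suc i} {zero}  _   = pairSum-comm (pairSum-shift shift (withAnchor i))
  pairSum′ {suc i} {suc j} i≢j = pairSum-⊆ T⊆C (pairSum (i≢j ∘ cong suc))

gapFree⇒noCollision : ∀ {k δ T} → 1 ≤ δ → GapFree δ T → (A : AnchoredConfig k T) →
  let open AnchoredConfig A in ∀ i → b i ≢ b anchor ℤ.+ double δ
gapFree⇒noCollision {δ = δ@(suc _)} {T} (s≤s z≤n) free A i b[i]≡b[a]+2δ = collide (i Fin.≟ anchor)
  where
  open AnchoredConfig A
  collide : Dec (i ≡ anchor) → ⊥
  collide (yes refl) with () ← +-identityʳ-unique (b i) (double δ) (sym b[i]≡b[a]+2δ)
  collide (no i≢a) with pairSum (i≢a ∘ sym) | anchorSum
  ... | withMidpoint c c∈T a+i≡2c | withMidpoint c₀ c₀∈T a+a≡2c₀ = free c₀∈T (subst (_∈ T) c≡c₀+δ c∈T)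
    where
    open ≡-Reasoning
    c≡c₀+δ : c ≡ c₀ + δ
    c≡c₀+δ = double-injective (begin
      double c                                ≡⟨ a+i≡2c ⟨
      b anchor ℤ.+ b i                        ≡⟨ cong (λ z → b anchor ℤ.+ z) b[i]≡b[a]+2δ ⟩
      b anchor ℤ.+ (b anchor ℤ.+ double δ)    ≡⟨ ℤ.+-assoc (b anchor) (b anchor) (double δ) ⟨
      b anchor ℤ.+ b anchor ℤ.+ double δ      ≡⟨ cong (ℤ._+ double δ) a+a≡2c₀ ⟩
      double c₀ ℤ.+ double δ                  ≡⟨ double-+ c₀ δ ⟩
      double (c₀ + δ)                         ∎)

triangle : ∀ {C} x y z {c₁ c₂ c₃} → c₁ ∈ C → c₂ ∈ C → c₃ ∈ C → c₁ ≢ c₂ → c₁ ≢ c₃ → c₂ ≢ c₃ →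
  x ℤ.+ y ≡ double c₁ → x ℤ.+ z ≡ double c₂ → y ℤ.+ z ≡ double c₃ → SumConfig 3 C
triangle {C} x y z {c₁} {c₂} {c₃} c₁∈ c₂∈ c₃∈ c₁≢c₂ c₁≢c₃ c₂≢c₃ xy xz yz = record
  { b = b ; injective = injective ; pairSum = pairSum }
  where
  b : Fin 3 → ℤ
  b zero             = x
  b (suc zero)       = y
  b (suc (suc zero)) = z
  x≢y : x ≢ y
  x≢y x≡y = c₂≢c₃ (double-injective (trans (sym xz) (trans (cong (ℤ._+ z) x≡y) yz)))
  x≢z : x ≢ z
  x≢z x≡z = c₁≢c₃ (double-injective (trans (sym xy) (trans (cong (ℤ._+ y) x≡z) (trans (ℤ.+-comm z y) yz))))
  y≢z : y ≢ z
  y≢z y≡z = c₁≢c₂ (double-injective (trans (sym xy) (trans (cong (λ w → x ℤ.+ w) y≡z) xz)))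
  injective : Injective _≡_ _≡_ b
  injective {zero}           {zero}           _ = refl
  injective {zero}           {suc zero}       e = ⊥-elim (x≢y e)
  injective {zero}           {suc (suc zero)} e = ⊥-elim (x≢z e)
  injective {suc zero}       {zero}           e = ⊥-elim (x≢y (sym e))
  injective {suc zero}       {suc zero}       _ = refl
  injective {suc zero}       {suc (suc zero)} e = ⊥-elim (y≢z e)
  injective {suc (suc zero)} {zero}           e = ⊥-elim (x≢z (sym e))
  injective {suc (suc zero)} {suc zero}       e = ⊥-elim (y≢z (sym e))
  injective {suc (suc zero)} {suc (suc zero)} _ = refl
  pairSum : ∀ {i j} → i ≢ j → PairSum C (b i) (b j)
  pairSum {zero}           {suc zero}       _   = withMidpoint c₁ c₁∈ xy
  pairSum {zero}           {suc (suc zero)} _   = withMidpoint c₂ c₂∈ xz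
  pairSum {suc zero}       {suc (suc zero)} _   = withMidpoint c₃ c₃∈ yz
  pairSum {suc zero}       {zero}           _   = pairSum-comm (withMidpoint c₁ c₁∈ xy)
  pairSum {suc (suc zero)} {zero}           _   = pairSum-comm (withMidpoint c₂ c₂∈ xz)
  pairSum {suc (suc zero)} {suc zero}       _   = pairSum-comm (withMidpoint c₃ c₃∈ yz)
  pairSum {zero}           {zero}           i≢i = ⊥-elim (i≢i refl)
  pairSum {suc zero}       {suc zero}       i≢i = ⊥-elim (i≢i refl)
  pairSum {suc (suc zero)} {suc (suc zero)} i≢i = ⊥-elim (i≢i refl)

threeConfig : ∀ C → Sorted C → 3 ≤ length C → SumConfig 3 C
threeConfig (c₀ ∷ c₁ ∷ c₂ ∷ C) ((c₀<c₁ ∷ c₀<c₂ ∷ _) ∷ (c₁<c₂ ∷ _) ∷ _) _ =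
  triangle (p ℤ.+ q ℤ.- r) (p ℤ.- q ℤ.+ r) (ℤ.- p ℤ.+ q ℤ.+ r)
    (here refl) (there (here refl)) (there (there (here refl)))
    (ℕ.<⇒≢ c₀<c₁) (ℕ.<⇒≢ c₀<c₂) (ℕ.<⇒≢ c₁<c₂)
    (xy p q r) (xz p q r) (yz p q r)
  where
  p q r : ℤ
  p = + c₀
  q = + c₁
  r = + c₂
  xy : ∀ p q r → (p ℤ.+ q ℤ.- r) ℤ.+ (p ℤ.- q ℤ.+ r) ≡ p ℤ.+ p
  xy = ℤ-Solver.solve-∀
  xz : ∀ p q r → (p ℤ.+ q ℤ.- r) ℤ.+ (ℤ.- p ℤ.+ q ℤ.+ r) ≡ q ℤ.+ q
  xz = ℤ-Solver.solve-∀
  yz : ∀ p q r → (p ℤ.- q ℤ.+ r) ℤ.+ (ℤ.- p ℤ.+ q ℤ.+ r) ≡ r ℤ.+ r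
  yz = ℤ-Solver.solve-∀
threeConfig (_ ∷ [])     _ (s≤s ())
threeConfig (_ ∷ _ ∷ []) _ (s≤s (s≤s ()))

reflect : ℕ → ℕ → ℤ
reflect e p = double p ℤ.- + e

reflect-sum : ∀ e p q r → p + q ≡ e + r → reflect e p ℤ.+ reflect e q ≡ double r
reflect-sum e p q r p+q≡e+r = begin
  reflect e p ℤ.+ reflect e q              ≡⟨ regroup (+ p) (+ q) (+ e) ⟩
  double (p + q) ℤ.- double e              ≡⟨ cong (λ s → double s ℤ.- double e) p+q≡e+r ⟩
  double (e + r) ℤ.- double e              ≡⟨ cancel (+ e) (+ r) ⟩
  double r                                 ∎
  where
  open ≡-Reasoning
  regroup : ∀ p q e → (p ℤ.+ p ℤ.- e) ℤ.+ (q ℤ.+ q ℤ.- e) ≡ (p ℤ.+ q) ℤ.+ (p ℤ.+ q) ℤ.- (e ℤ.+ e)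
  regroup = ℤ-Solver.solve-∀
  cancel : ∀ e r → (e ℤ.+ r) ℤ.+ (e ℤ.+ r) ℤ.- (e ℤ.+ e) ≡ r ℤ.+ r
  cancel = ℤ-Solver.solve-∀

reflect-collision : ∀ e p δ → reflect e p ≡ reflect e e ℤ.+ double δ → p ≡ e + δ
reflect-collision e p δ collision = double-injective (begin
  double p                            ≡⟨ unreflect (+ p) (+ e) ⟩
  reflect e p ℤ.+ + e                 ≡⟨ cong (ℤ._+ + e) collision ⟩
  reflect e e ℤ.+ double δ ℤ.+ + e    ≡⟨ regroup (+ e) (+ δ) ⟩
  double (e + δ)                      ∎)
  where
  open ≡-Reasoning
  unreflect : ∀ p e → p ℤ.+ p ≡ p ℤ.+ p ℤ.- e ℤ.+ e
  unreflect = ℤ-Solver.solve-∀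
  regroup : ∀ e d → e ℤ.+ e ℤ.- e ℤ.+ (d ℤ.+ d) ℤ.+ e ≡ (e ℤ.+ d) ℤ.+ (e ℤ.+ d)
  regroup = ℤ-Solver.solve-∀

-- The triple (w, w + 2d, 2v − w) has pairwise sums 2(w + d), 2v and 2(v + d); w is its anchor.
quadrupleConfig : ∀ {δ d S C v w} → 1 ≤ δ → 1 ≤ d → d ≢ δ → S ⊆ C → (∀ {c} → c ∈ S → c + δ ∈ C) →
  v < w → v ∈ gapStarts d S → w ∈ gapStarts d S → AnchoredConfig 4 C
quadrupleConfig {δ} {d} {S} {C} {v} {w} 1≤δ 1≤d d≢δ S⊆C shift v<w v∈ w∈ =
  extend S⊆C shift A noCollision
  where
  v<w+d : v < w + d
  v<w+d = ℕ.<-≤-trans v<w (ℕ.m≤m+n w d)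
  swap : ∀ w d v → w + d + v ≡ w + (v + d)
  swap = solve-∀
  A : AnchoredConfig 3 S
  A = record
    { config    = triangle (reflect w w) (reflect w (w + d)) (reflect w v)
                    (gapStarts-shift w∈) (gapStarts-⊆ v∈) (gapStarts-shift v∈)
                    (ℕ.<⇒≢ v<w+d ∘ sym) (ℕ.<⇒≢ (ℕ.+-monoˡ-< d v<w) ∘ sym) (ℕ.<⇒≢ (ℕ.m<m+n v 1≤d))
                    (reflect-sum w w (w + d) (w + d) refl) (reflect-sum w w v v refl)
                    (reflect-sum w (w + d) v (v + d) (swap w d v))
    ; anchor    = zero
    ; anchorSum = withMidpoint w (gapStarts-⊆ w∈) (reflect-sum w w w w refl)
    }
  noCollision : ∀ i → AnchoredConfig.b A i ≢ AnchoredConfig.b A zero ℤ.+ double δ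
  noCollision zero             c = ℕ.<⇒≢ (ℕ.m<m+n w 1≤δ) (reflect-collision w w δ c)
  noCollision (suc zero)       c = d≢δ (ℕ.+-cancelˡ-≡ w d δ (reflect-collision w (w + d) δ c))
  noCollision (suc (suc zero)) c = ℕ.<⇒≢ (ℕ.<-≤-trans v<w (ℕ.m≤m+n w δ)) (reflect-collision w v δ c)

isqrt : ∀ N → ∃[ t ] t * t ≤ N × N < suc t * suc t
isqrt zero    = 0 , z≤n , s≤s z≤n
isqrt (suc N) with isqrt N
... | t , t²≤N , N<[1+t]² with suc N ℕ.<? suc t * suc t
...   | yes 1+N<[1+t]² = t , ℕ.m≤n⇒m≤1+n t²≤N , 1+N<[1+t]²
...   | no 1+N≮[1+t]²  = suc t , ℕ.≮⇒≥ 1+N≮[1+t]² ,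
          ℕ.≤-<-trans N<[1+t]² (ℕ.*-mono-< (ℕ.n<1+n (suc t)) (ℕ.n<1+n (suc t)))

sandwich-cancel : ∀ N t r F → 1 ≤ N → r + 2 * N * (2 * t + 3) ≤ r * r → r * r ≤ r + 2 * (N * F) →
  2 * t + 3 ≤ F
sandwich-cancel N t r F 1≤N lower upper =
  ℕ.*-cancelˡ-≤ (2 * N) {{>-nonZero (ℕ.≤-trans (s≤s z≤n) (ℕ.*-monoʳ-≤ 2 1≤N))}}
    (ℕ.+-cancelˡ-≤ r _ _ (ℕ.≤-trans lower (subst (λ x → r * r ≤ r + x) (sym (ℕ.*-assoc 2 N F)) upper)))

repeated-gap-arith : ∀ N t s → 1 ≤ N → N < suc t * suc t → 2 * t + 3 ≤ s → 3 * s + 2 * suc N ≤ s * s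
repeated-gap-arith (suc N) zero    s _ (s≤s ()) _
repeated-gap-arith N       (suc t) s _ N<[2+t]² 2t+3≤s =
  subst (λ s → 3 * s + 2 * suc N ≤ s * s) (ℕ.m+[n∸m]≡n 2t+3≤s) (begin
    3 * s′ + 2 * suc N                                 ≤⟨ ℕ.+-monoʳ-≤ (3 * s′) (ℕ.*-monoʳ-≤ 2 N<[2+t]²) ⟩
    3 * s′ + 2 * ((2 + t) * (2 + t))                   ≤⟨ ℕ.m≤m+n _ _ ⟩
    3 * s′ + 2 * ((2 + t) * (2 + t)) + surplus         ≡⟨ expand t u ⟩
    s′ * s′                                            ∎)
  where
  open ℕ.≤-Reasoning
  u s′ surplus : ℕ
  u = s ∸ (2 * suc t + 3)
  s′ = 2 * suc t + 3 + u
  surplus = 2 * (t * t) + 6 * t + 2 + u * (4 * t + 7) + u * u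
  expand : ∀ t u → 3 * (2 * (1 + t) + 3 + u) + 2 * ((2 + t) * (2 + t))
                   + (2 * (t * t) + 6 * t + 2 + u * (4 * t + 7) + u * u)
                 ≡ (2 * (1 + t) + 3 + u) * (2 * (1 + t) + 3 + u)
  expand = solve-∀

fourConfig : ∀ N C → 1 ≤ N → Sorted C → Spread≤ N C → FBound 4 (2 * N) (toℚ (length C)) →
  AnchoredConfig 4 C
fourConfig N C 1≤N sorted spread bound =
  let t , t²≤N , N<[1+t]² = isqrt N
      δ , 1≤δ , r²≤r+2Ns = popular-gap N C 1≤N sorted spread
      S = gapStarts δ C
      2t+3≤s = sandwich-cancel N t (length C) (length S) 1≤N
                 (FBound₄⇒ N t (length C) 1≤N t²≤N bound) r²≤r+2Ns
      d , 1≤d , d≢δ , 2≤F[d] = repeated-gap N δ S (gapStarts-sorted sorted) (Spread≤-⊆ gapStarts-⊆ spread)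
                                 (repeated-gap-arith N t (length S) 1≤N N<[1+t]² 2t+3≤s)
      v , w , v<w , v∈ , w∈ = sorted-pair (gapStarts d S)
                                (gapStarts-sorted (gapStarts-sorted sorted)) 2≤F[d]
  in quadrupleConfig 1≤δ 1≤d d≢δ gapStarts-⊆ gapStarts-shift v<w v∈ w∈

anchoredConfig : ∀ j N C → 1 ≤ N → Sorted C → Spread≤ N C → FBound (4 + j) (2 * N) (toℚ (length C)) →
  AnchoredConfig (4 + j) C
anchoredConfig zero    = fourConfig
anchoredConfig (suc j) N C 1≤N sorted spread bound =
  let δ , 1≤δ , r²≤r+2Ns = popular-gap N C 1≤N sorted spread
      T , T⊆S , sortedT , s≤2t , free = halve δ {{>-nonZero 1≤δ}} (gapStarts δ C) (gapStarts-sorted sorted)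
      T⊆C : T ⊆ C
      T⊆C = gapStarts-⊆ ∘ T⊆S
      A = anchoredConfig j N T 1≤N sortedT (Spread≤-⊆ T⊆C spread)
            (FBound-descend j (2 * N) (length C) (length T) (ℕ.≤-trans 1≤N (ℕ.m≤n*m N 2)) bound
              (ℕ.≤-trans r²≤r+2Ns (ℕ.+-monoʳ-≤ (length C) (halving-arith N _ _ s≤2t))))
  in extend T⊆C (gapStarts-shift ∘ T⊆S) A (gapFree⇒noCollision 1≤δ free A)
  where
  regroup : ∀ N t → 2 * (N * (2 * t)) ≡ 2 * (2 * N) * t
  regroup = solve-∀
  halving-arith : ∀ N s t → s ≤ 2 * t → 2 * (N * s) ≤ 2 * (2 * N) * t
  halving-arith N s t s≤2t = ℕ.≤-trans (ℕ.*-monoʳ-≤ 2 (ℕ.*-monoʳ-≤ N s≤2t)) (ℕ.≤-reflexive (regroup N t))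

sumConfig : ∀ k N C → 3 ≤ k → 1 ≤ N → Sorted C → Spread≤ N C → FBound k (2 * N) (toℚ (length C)) →
  SumConfig k C
sumConfig 1 N C (s≤s ())
sumConfig 2 N C (s≤s (s≤s ()))
sumConfig 3 N C _ 1≤N sorted spread bound = threeConfig C sorted (FBound₃⇒3≤ N (length C) 1≤N bound)
sumConfig (suc (suc (suc (suc j)))) N C _ 1≤N sorted spread bound =
  AnchoredConfig.config (anchoredConfig j N C 1≤N sorted spread bound)

increasing⇒monotone : ∀ {n} (f : Fin n → ℕ) → (∀ i j → i Fin.< j → f i < f j) →
  ∀ {i j} → i Fin.≤ j → f i ≤ f j
increasing⇒monotone f increasing {i} {j} i≤j with i Fin.≟ j
... | yes refl = ℕ.≤-refl
... | no i≢j   = ℕ.<⇒≤ (increasing i j (Fin.≤∧≢⇒< i≤j i≢j))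

tabulate-spread : ∀ {n} (h : Fin (suc n) → ℕ) → (∀ i j → i Fin.< j → h i < h j) →
  Spread≤ (h (fromℕ n) ∸ h zero) (tabulate h)
tabulate-spread {n} h increasing v∈ w∈ with ∈-tabulate⁻ {f = h} v∈ | ∈-tabulate⁻ {f = h} w∈
... | i , refl | j , refl = begin
  h j                               ≤⟨ monotone (Fin.≤fromℕ j) ⟩
  h (fromℕ n)                       ≡⟨ ℕ.m+[n∸m]≡n (monotone {zero} {fromℕ n} z≤n) ⟨
  h zero + (h (fromℕ n) ∸ h zero)   ≤⟨ ℕ.+-monoˡ-≤ _ (monotone {zero} {i} z≤n) ⟩
  h i + (h (fromℕ n) ∸ h zero)      ∎
  where
  open ℕ.≤-Reasoning
  monotone : ∀ {i j} → i Fin.≤ j → h i ≤ h j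
  monotone = increasing⇒monotone h increasing

pairSum-tabulate : ∀ {n} (h : Fin n → ℕ) {x y} → PairSum (tabulate h) x y → ∃[ l ] x ℤ.+ y ≡ double (h l)
pairSum-tabulate h (withMidpoint c c∈ x+y≡2c) with ∈-tabulate⁻ {f = h} c∈
... | l , refl = l , x+y≡2c

m/2+m/2≡m : ∀ {m} → 2 ∣ m → m / 2 + m / 2 ≡ m
m/2+m/2≡m {m} 2∣m = trans (n+n≡2*n (m / 2)) (DivMod.m*[n/m]≡n 2∣m)

/2-increasing : ∀ {n} (a : Fin n → ℕ) → (∀ i → 2 ∣ a i) → (∀ i j → i Fin.< j → a i < a j) →
  ∀ i j → i Fin.< j → a i / 2 < a j / 2
/2-increasing a 2∣a increasing i j i<j = ℕ.*-cancelˡ-< 2 (a i / 2) (a j / 2)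
  (subst₂ _<_ (sym (DivMod.m*[n/m]≡n (2∣a i))) (sym (DivMod.m*[n/m]≡n (2∣a j))) (increasing i j i<j))

2*[m/2∸n/2]≡m∸n : ∀ {m n} → 2 ∣ m → 2 ∣ n → 2 * (m / 2 ∸ n / 2) ≡ m ∸ n
2*[m/2∸n/2]≡m∸n {m} {n} 2∣m 2∣n =
  trans (ℕ.*-distribˡ-∸ 2 (m / 2) (n / 2)) (cong₂ _∸_ (DivMod.m*[n/m]≡n 2∣m) (DivMod.m*[n/m]≡n 2∣n))

1≤2*n⇒1≤n : ∀ {n} → 1 ≤ 2 * n → 1 ≤ n
1≤2*n⇒1≤n {suc n} _ = s≤s z≤n

-- The hypothesis 2 ≤ a 0 is not needed.
lemma8 : (k : ℕ) → 3 ≤ k →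
  (m : ℕ) → (a : Fin (suc m) → ℕ) →
  (∀ i j → i Fin.< j → a i < a j) →
  (∀ i → 2 ∣ a i) →
  2 ≤ a Fin.zero →
  1 ≤ a (fromℕ m) ∸ a Fin.zero →
  FBound k (a (fromℕ m) ∸ a Fin.zero) (toℚ (suc m)) →
  Σ (Fin k → ℤ) λ b →
    Injective _≡_ _≡_ b ×
    (∀ i j → i Fin.< j → Σ (Fin (suc m)) λ l → b i ℤ.+ b j ≡ + a l)
lemma8 k 3≤k m a increasing 2∣a _ 1≤x bound =
  b , injective , λ i j i<j →
    let l , b[i]+b[j]≡2c = pairSum-tabulate half (pairSum (Fin.<⇒≢ i<j))
    in l , trans b[i]+b[j]≡2c (cong +_ (m/2+m/2≡m (2∣a l)))
  where
  half : Fin (suc m) → ℕ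
  half i = a i / 2
  2N≡x : 2 * (half (fromℕ m) ∸ half zero) ≡ a (fromℕ m) ∸ a zero
  2N≡x = 2*[m/2∸n/2]≡m∸n (2∣a (fromℕ m)) (2∣a zero)
  half-increasing : ∀ i j → i Fin.< j → half i < half j
  half-increasing = /2-increasing a 2∣a increasing
  open SumConfig (sumConfig k (half (fromℕ m) ∸ half zero) (tabulate half) 3≤k
    (1≤2*n⇒1≤n (subst (1 ≤_) (sym 2N≡x) 1≤x))
    (AllPairs.tabulate⁺-< (half-increasing _ _)) (tabulate-spread half half-increasing)
    (subst₂ (FBound k) (sym 2N≡x) (cong toℚ (sym (List.length-tabulate half))) bound))
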